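{- (1) If $\mathcal{J}$ is a T-maximal ideal on $\mathbb{N}$, then $\mathcal{J}=t(\mathcal{I})$ for every maximal ideal $\mathcal{I}\supseteq\mathcal{J}$. (2) There is a maximal ideal $\mathcal{I}$ on $\mathbb{N}$ such that $t(\mathcal{I})$ is not a T-maximal ideal. (3) No T-maximal ideal has the Baire property.
   Context: For $A\subseteq\mathbb{N}$ and $k\in\mathbb{Z}$, $A+k$ denotes $\{a+k:a\in A\}\cap\mathbb{N}$. An ideal on $\mathbb{N}$ is a family $\mathcal{I}\subseteq\mathcal{P}(\mathbb{N})$ closed under finite unions and subsets, containing all finite subsets of $\mathbb{N}$, with $\mathbb{N}\notin\mathcal{I}$; it is maximal if it is not properly contained in another ideal on $\mathbb{N}$, and translation invariant if $A+k\in\mathcal{I}$ for all $A\in\mathcal{I}$, $k\in\mathbb{Z}$. A translation invariant ideal $\mathcal{I}$ is T-maximal if for every translation invariant ideal $\mathcal{J}$, $\mathcal{I}\subseteq\mathcal{J}$ implies $\mathcal{I}=\mathcal{J}$. For an ideal $\mathcal{I}$, $t(\mathcal{I})=\{A\subseteq\mathbb{N}:A+k\in\mathcal{I}\text{ for every }k\in\mathbb{Z}\}$. Subsets of $\mathbb{N}$ are identified with their characteristic functions, so $\mathcal{P}(\mathbb{N})$ carries the topology of the Cantor space $\{0,1\}^{\mathbb{N}}$; an ideal has the Baire property if it has the Baire property as a subset of this space. -}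

module Defs where

open import Level using (Level; 0ℓ) renaming (suc to lsuc)
open import Data.Nat using (ℕ; zero; suc; _+_; _∸_; _≤_; _≤ᵇ_)
open import Data.Integer using (ℤ; +_; -[1+_])
open import Data.Bool using (Bool; true; false; _∨_; if_then_else_)
open import Data.List using (List; []; _∷_; _++_)
open import Data.Product using (Σ; ∃; _×_; _,_)
open import Data.Sum using (_⊎_)
open import Data.Unit using (⊤)
open import Relation.Nullary using (¬_)
open import Relation.Binary.PropositionalEquality using (_≡_)

-- Subsets of ℕ, identified with their characteristic functions (points of {0,1}^ℕ).
Subset : Set
Subset = ℕ → Bool

_⊆ₛ_ : Subset → Subset → Set
A ⊆ₛ B = ∀ n → A n ≡ true → B n ≡ true

_∪ₛ_ : Subset → Subset → Subset
(A ∪ₛ B) n = A n ∨ B n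

FullSet : Subset
FullSet _ = true

FiniteSet : Subset → Set
FiniteSet A = ∃ λ m → ∀ n → m ≤ n → A n ≡ false

-- A + k = {a + k : a ∈ A} ∩ ℕ
shift : Subset → ℤ → Subset
shift A (+ m) n = if m ≤ᵇ n then A (n ∸ m) else false
shift A -[1+ m ] n = A (n + suc m)

Family : Set₁
Family = Subset → Set

_⊑_ : Family → Family → Set
I ⊑ J = ∀ A → I A → J A

record IsIdeal (I : Family) : Set where
  field
    ∪-closed    : ∀ A B → I A → I B → I (A ∪ₛ B)
    ⊆-closed    : ∀ A B → A ⊆ₛ B → I B → I A
    finite-mem  : ∀ A → FiniteSet A → I A
    proper      : ¬ I FullSet

TranslationInvariant : Family → Set
TranslationInvariant I = ∀ A (k : ℤ) → I A → I (shift A k)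

IsMaximalIdeal : Family → Set₁
IsMaximalIdeal I = IsIdeal I × (∀ J → IsIdeal J → I ⊑ J → J ⊑ I)

IsTMaximal : Family → Set₁
IsTMaximal I = IsIdeal I × TranslationInvariant I ×
  (∀ J → IsIdeal J → TranslationInvariant J → I ⊑ J → J ⊑ I)

t : Family → Family
t I A = ∀ (k : ℤ) → I (shift A k)

_≐_ : Family → Family → Set
I ≐ J = I ⊑ J × J ⊑ I

-- x lies in the basic clopen set [s] determined by the finite string s
Extends : Subset → List Bool → Set
Extends x []      = ⊤
Extends x (b ∷ s) = x 0 ≡ b × Extends (λ n → x (suc n)) s

-- the open set generated by a set W of finite strings: ⋃_{s ∈ W} [s]
-- (every open subset of the Cantor space is of this form)
InOpen : (List Bool → Set) → Subset → Set
InOpen W x = ∃ λ s → W s × Extends x s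

-- N is nowhere dense: every basic open [s] has a basic open subset [s ++ t] disjoint from N
NowhereDense : Family → Set
NowhereDense N = ∀ s → ∃ λ u → ∀ x → Extends x (s ++ u) → ¬ N x

Meager : Family → Set₁
Meager M = Σ (ℕ → Family) λ N →
  (∀ n → NowhereDense (N n)) × (∀ x → M x → ∃ λ n → N n x)

HasBaireProperty : Family → Set₁
HasBaireProperty X = Σ (List Bool → Set) λ W →
  Meager (λ x → (X x × ¬ InOpen W x) ⊎ (InOpen W x × ¬ X x))

-- Law of excluded middle (for Set₁, hence also for Set via Lift)
LEM : Set₂
LEM = (P : Set₁) → P ⊎ ¬ P

-- Every ideal on ℕ is contained in a maximal ideal (Zorn / ultrafilter lemma)
IdealExtension : Set₁
IdealExtension = ∀ J → IsIdeal J → Σ Family λ I → IsMaximalIdeal I × J ⊑ I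

-- (1) t(I) is a translation invariant ideal containing every translation invariant J ⊆ I,
-- so a T-maximal J ⊆ I equals t(I).
-- Call A thin for J if no member of J covers ℕ together with a bounded neighbourhood of A.
-- For translation invariant J and A thin for J, the ideal generated by J and the translates
-- of A is proper and translation invariant, so a T-maximal ideal contains every thin set.
-- (2) Take a maximal I containing every set that meets the triangular numbers T finitely.
-- Since the gaps of T grow, T is thin for t(I); but ℕ ∖ T ∈ I, so T ∉ t(I) and t(I) is not
-- T-maximal.
-- (3) Let J be T-maximal with the Baire property. If J is comeager in a basic open set [s],
-- a point x such that s⌢x and s⌢(ℕ ∖ x) are both generic puts x and ℕ ∖ x into J, after
-- translating back by |s|. Otherwise J is meager, J ⊆ ⋃ Nₙ with Nₙ nowhere dense; build
-- A, D outside ⋃ Nₙ whose elements lie ever farther apart. Then A is thin for J, since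
-- otherwise D would lie in J; so A ∈ J ⊆ ⋃ Nₙ, a contradiction.

module Submission where

open import Defs
open import Level using (Lift; lift)
open import Data.Nat as ℕ
  using (ℕ; zero; suc; _≤_; _<_; _≤ᵇ_; _<ᵇ_; _∸_; z≤n; s≤s; z<s; _≤′_; ≤′-reflexive; ≤′-step)
open import Data.Nat.Properties
open import Data.Integer as ℤ using (ℤ; +_; -[1+_]; -_)
import Data.Integer.Properties as ℤ
open import Data.Integer.Tactic.RingSolver using (solve-∀)
open import Data.Bool using (Bool; true; false; _∨_; not)
open import Data.Bool.Properties using (T-≡; ∨-inverseʳ; not-injective; not-involutive)
open import Data.List using (List; []; _∷_; _++_; length; replicate; map)
open import Data.List.Properties
  using (++-identityʳ; ++-assoc; length-++; length-++-≤ʳ; length-replicate; map-++; map-∘; map-cong; map-id)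
open import Data.Fin using (Fin; toℕ; fromℕ<)
open import Data.Fin.Properties using (any?; toℕ-fromℕ<)
open import Data.Unit using (tt)
open import Data.Product using (Σ; ∃; _×_; _,_; proj₁; proj₂; uncurry)
open import Data.Sum using (_⊎_; inj₁; inj₂)
import Data.Sum as ⊎
open import Data.Empty using (⊥; ⊥-elim)
open import Function using (Equivalence)
open import Relation.Nullary using (¬_; yes; no)
open import Relation.Nullary.Negation using (DoubleNegation)
open import Relation.Nullary.Decidable using (isYes; toWitness; fromWitness)
open import Relation.Binary.PropositionalEquality

true≢false : ∀ {b} → b ≡ true → b ≡ false → ⊥
true≢false refl ()

∨-≡-true : ∀ {a b} → (a ∨ b) ≡ true → a ≡ true ⊎ b ≡ true
∨-≡-true {true}  _ = inj₁ refl
∨-≡-true {false} e = inj₂ e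

⊆-∪ˡ : ∀ A B → A ⊆ₛ (A ∪ₛ B)
⊆-∪ˡ A B n e rewrite e = refl

⊆-∪ʳ : ∀ A B → B ⊆ₛ (A ∪ₛ B)
⊆-∪ʳ A B n e with A n
... | true  = refl
... | false = e

∁ : Subset → Subset
∁ A n = not (A n)

Below : ℕ → Subset
Below c n = n <ᵇ c

Below-intro : ∀ {c n} → n < c → Below c n ≡ true
Below-intro n<c = Equivalence.to T-≡ (<⇒<ᵇ n<c)

Below-finite : ∀ c → FiniteSet (Below c)
Below-finite c = c , vanishes
  where
  vanishes : ∀ n → c ≤ n → Below c n ≡ false
  vanishes n c≤n with n <ᵇ c in n<ᵇc
  ... | false = refl
  ... | true  = ⊥-elim (<⇒≱ (<ᵇ⇒< n c (Equivalence.from T-≡ n<ᵇc)) c≤n)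

module _ {I : Family} (I-ideal : IsIdeal I) where
  open IsIdeal I-ideal

  ∁-∉ : ∀ A → I A → ¬ I (∁ A)
  ∁-∉ A IA I∁A = proper (⊆-closed FullSet (A ∪ₛ ∁ A) (λ n _ → ∨-inverseʳ (A n)) (∪-closed A (∁ A) IA I∁A))

-- Translation and the operator t

≤ᵇ-true : ∀ {m n} → m ≤ n → (m ≤ᵇ n) ≡ true
≤ᵇ-true m≤n = Equivalence.to T-≡ (≤⇒≤ᵇ m≤n)

shift-elim : ∀ A k n → shift A k n ≡ true → ∃ λ r → A r ≡ true × + r ℤ.+ k ≡ + n
shift-elim A (+ b) n e with b ≤ᵇ n in b≤ᵇn
... | true = n ∸ b , e , cong +_ (m∸n+n≡m (≤ᵇ⇒≤ b n (Equivalence.from T-≡ b≤ᵇn)))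
shift-elim A -[1+ b ] n e =
  n ℕ.+ suc b , e , trans (ℤ.⊖-≥ (m≤n+m (suc b) n)) (cong +_ (m+n∸n≡m n (suc b)))

i≡[i+j]-j : ∀ i j → i ≡ i ℤ.+ j ℤ.- j
i≡[i+j]-j = solve-∀

[i+j]-i≡j : ∀ i j → i ℤ.+ j ℤ.- i ≡ j
[i+j]-i≡j = solve-∀

shift-intro : ∀ A k {r n} → A r ≡ true → + r ℤ.+ k ≡ + n → shift A k n ≡ true
shift-intro A (+ b) {r} Ar refl rewrite ≤ᵇ-true (m≤n+m b r) = subst (λ z → A z ≡ true) (sym (m+n∸n≡m r b)) Ar
shift-intro A -[1+ b ] {r} {n} Ar r+k≡n = subst (λ z → A z ≡ true) (ℤ.+-injective r≡n-k) Ar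
  where
  r≡n-k : + r ≡ + n ℤ.- -[1+ b ]
  r≡n-k = trans (i≡[i+j]-j (+ r) -[1+ b ]) (cong (ℤ._- -[1+ b ]) r+k≡n)

shift-mono : ∀ {A B} k → A ⊆ₛ B → shift A k ⊆ₛ shift B k
shift-mono {A} {B} k A⊆B n e with shift-elim A k n e
... | r , Ar , eq = shift-intro B k (A⊆B r Ar) eq

shift-∪ : ∀ A B k → shift (A ∪ₛ B) k ⊆ₛ (shift A k ∪ₛ shift B k)
shift-∪ A B k n e with shift-elim (A ∪ₛ B) k n e
... | r , A∪Br , eq with ∨-≡-true {A r} A∪Br
...   | inj₁ Ar = ⊆-∪ˡ (shift A k) (shift B k) n (shift-intro A k Ar eq)
...   | inj₂ Br = ⊆-∪ʳ (shift A k) (shift B k) n (shift-intro B k Br eq)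

shift-shift : ∀ A k j → shift (shift A k) j ⊆ₛ shift A (k ℤ.+ j)
shift-shift A k j n e with shift-elim (shift A k) j n e
... | r′ , A+kr′ , r′+j≡n with shift-elim A k r′ A+kr′
...   | r , Ar , r+k≡r′ = shift-intro A (k ℤ.+ j) Ar (begin
  + r ℤ.+ (k ℤ.+ j) ≡⟨ sym (ℤ.+-assoc (+ r) k j) ⟩
  + r ℤ.+ k ℤ.+ j   ≡⟨ cong (ℤ._+ j) r+k≡r′ ⟩
  + r′ ℤ.+ j        ≡⟨ r′+j≡n ⟩
  + n               ∎)
  where open ≡-Reasoning

⊆-shift-0 : ∀ A → A ⊆ₛ shift A (+ 0)
⊆-shift-0 A n An = shift-intro A (+ 0) An (ℤ.+-identityʳ (+ n))

shift-finite : ∀ A k → FiniteSet A → FiniteSet (shift A k)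
shift-finite A (+ b) (c , A-vanishes) = c ℕ.+ b , vanishes
  where
  vanishes : ∀ n → c ℕ.+ b ≤ n → shift A (+ b) n ≡ false
  vanishes n c+b≤n with shift A (+ b) n in e
  ... | false = refl
  ... | true with shift-elim A (+ b) n e
  ...   | r , Ar , refl = ⊥-elim (true≢false Ar (A-vanishes r (+-cancelʳ-≤ b c r c+b≤n)))
shift-finite A -[1+ b ] (c , A-vanishes) =
  c , λ n c≤n → A-vanishes (n ℕ.+ suc b) (≤-trans c≤n (m≤m+n n (suc b)))

module _ {I : Family} (I-ideal : IsIdeal I) where
  open IsIdeal I-ideal

  t-isIdeal : IsIdeal (t I)
  t-isIdeal = record
    { ∪-closed   = λ A B tA tB k → ⊆-closed _ _ (shift-∪ A B k) (∪-closed _ _ (tA k) (tB k))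
    ; ⊆-closed   = λ A B A⊆B tB k → ⊆-closed _ _ (shift-mono k A⊆B) (tB k)
    ; finite-mem = λ A finA k → finite-mem _ (shift-finite A k finA)
    ; proper     = λ tℕ → proper (⊆-closed FullSet _ (⊆-shift-0 FullSet) (tℕ (+ 0)))
    }

  t-translationInvariant : TranslationInvariant (t I)
  t-translationInvariant A k tA j = ⊆-closed _ _ (shift-shift A k j) (tA (k ℤ.+ j))

TMaximal⇒≐t : (J : Family) → IsTMaximal J → (I : Family) → IsMaximalIdeal I → J ⊑ I → J ≐ t I
TMaximal⇒≐t J (_ , J-invariant , J-maximal) I (I-ideal , _) J⊑I =
  J⊑tI , J-maximal (t I) (t-isIdeal I-ideal) (t-translationInvariant I-ideal) J⊑tI
  where
  J⊑tI : J ⊑ t I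
  J⊑tI A JA k = J⊑I _ (J-invariant A k JA)

-- Thin sets

Near : Subset → ℕ → ℕ → Set
Near A m n = ∃ λ a → A a ≡ true × a ≤ n ℕ.+ m × n ≤ a ℕ.+ m

Near-mono : ∀ A {m m′} n → m ≤ m′ → Near A m n → Near A m′ n
Near-mono A n m≤m′ (a , Aa , a≤n+m , n≤a+m) =
  a , Aa , ≤-trans a≤n+m (+-monoʳ-≤ n m≤m′) , ≤-trans n≤a+m (+-monoʳ-≤ a m≤m′)

Near-+ : ∀ A m b r → Near A m r → Near A (m ℕ.+ b) (r ℕ.+ b)
Near-+ A m b r (a , Aa , a≤r+m , r≤a+m) =
  a , Aa , ≤-trans a≤r+m (≤-trans (+-monoʳ-≤ r (m≤m+n m b)) (+-monoˡ-≤ (m ℕ.+ b) (m≤m+n r b))) ,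
  ≤-trans (+-monoˡ-≤ b r≤a+m) (≤-reflexive (+-assoc a m b))

Near-∸ : ∀ A m b n → Near A m (n ℕ.+ b) → Near A (m ℕ.+ b) n
Near-∸ A m b n (a , Aa , a≤n+b+m , n+b≤a+m) =
  a , Aa , ≤-trans a≤n+b+m (≤-reflexive (trans (+-assoc n b m) (cong (n ℕ.+_) (+-comm b m)))) ,
  ≤-trans (m≤m+n n b) (≤-trans n+b≤a+m (+-monoʳ-≤ a (m≤m+n m b)))

Thin : Family → Subset → Set
Thin J A = ∀ m B → J B → ¬ (∀ n → B n ≡ true ⊎ Near A m n)

-- Since Near A m is covered by the translates A + k with |k| ≤ m, this is the
-- ideal generated by J together with all translates of A.
adjoin : Family → Subset → Family
adjoin J A Y = ∃ λ m → ∃ λ B → J B × (∀ n → Y n ≡ true → B n ≡ true ⊎ Near A m n)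

module _ {J : Family} (J-ideal : IsIdeal J) {A : Subset} where
  open IsIdeal J-ideal

  adjoin-isIdeal : Thin J A → IsIdeal (adjoin J A)
  adjoin-isIdeal A-thin = record
    { ∪-closed   = ∪-closed′
    ; ⊆-closed   = λ Y Y′ Y⊆Y′ (m , B , JB , cover) → m , B , JB , λ n Yn → cover n (Y⊆Y′ n Yn)
    ; finite-mem = λ F finF → 0 , F , finite-mem F finF , λ n Fn → inj₁ Fn
    ; proper     = λ (m , B , JB , cover) → A-thin m B JB (λ n → cover n refl)
    }
    where
    ∪-closed′ : ∀ Y Y′ → adjoin J A Y → adjoin J A Y′ → adjoin J A (Y ∪ₛ Y′)
    ∪-closed′ Y Y′ (m , B , JB , cover) (m′ , B′ , JB′ , cover′) =
      m ℕ.+ m′ , B ∪ₛ B′ , ∪-closed B B′ JB JB′ , cover″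
      where
      cover″ : ∀ n → (Y ∪ₛ Y′) n ≡ true → (B ∪ₛ B′) n ≡ true ⊎ Near A (m ℕ.+ m′) n
      cover″ n Y∪Y′n with ∨-≡-true {Y n} Y∪Y′n
      ... | inj₁ Yn  = ⊎.map (⊆-∪ˡ B B′ n) (Near-mono A n (m≤m+n m m′)) (cover n Yn)
      ... | inj₂ Y′n = ⊎.map (⊆-∪ʳ B B′ n) (Near-mono A n (m≤n+m m′ m)) (cover′ n Y′n)

  adjoin-∋ : adjoin J A A
  adjoin-∋ = 0 , Below 0 , finite-mem _ (Below-finite 0) , λ n An → inj₂ (n , An , m≤m+n n 0 , m≤m+n n 0)

adjoin-translationInvariant : ∀ {J A} → TranslationInvariant J → TranslationInvariant (adjoin J A)
adjoin-translationInvariant {A = A} J-invariant Y (+ b) (m , B , JB , cover) =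
  m ℕ.+ b , shift B (+ b) , J-invariant B (+ b) JB , cover′
  where
  cover′ : ∀ n → shift Y (+ b) n ≡ true → shift B (+ b) n ≡ true ⊎ Near A (m ℕ.+ b) n
  cover′ n Y+bn with shift-elim Y (+ b) n Y+bn
  ... | r , Yr , refl = ⊎.map (λ Br → shift-intro B (+ b) Br refl) (Near-+ A m b r) (cover r Yr)
adjoin-translationInvariant {A = A} J-invariant Y -[1+ b ] (m , B , JB , cover) =
  m ℕ.+ suc b , shift B -[1+ b ] , J-invariant B -[1+ b ] JB ,
  λ n Y-bn → ⊎.map₂ (Near-∸ A m (suc b) n) (cover (n ℕ.+ suc b) Y-bn)

⊑-adjoin : ∀ {J A} → J ⊑ adjoin J A
⊑-adjoin X JX = 0 , X , JX , λ n Xn → inj₁ Xn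

TMaximal-∋-thin : ∀ {J} → IsTMaximal J → ∀ {A} → Thin J A → J A
TMaximal-∋-thin (J-ideal , J-invariant , J-maximal) A-thin =
  J-maximal _ (adjoin-isIdeal J-ideal A-thin) (adjoin-translationInvariant J-invariant) ⊑-adjoin
    _ (adjoin-∋ J-ideal)

-- Sets with growing gaps

NearBelow : Subset → ℕ → ℕ → Set
NearBelow X m n = ∃ λ a → X a ≡ true × a < n × n ≤ a ℕ.+ m

GrowingGaps : Subset → Set
GrowingGaps X = ∀ m c → ∃ λ n → c ≤ n × X n ≡ true × ¬ NearBelow X m n

-- For X with growing gaps these are exactly the sets meeting X in a finite set; membership
-- is phrased through NearBelow because that is what the thinness argument below produces.
GapIdeal : Subset → Family
GapIdeal X Y = ∃ λ m → ∃ λ c → ∀ n → Y n ≡ true → n < c ⊎ X n ≡ false ⊎ NearBelow X m n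

module _ {X : Subset} where

  private
    weaken : ∀ {m m′ c c′ n} → m ≤ m′ → c ≤ c′ →
             n < c ⊎ X n ≡ false ⊎ NearBelow X m n → n < c′ ⊎ X n ≡ false ⊎ NearBelow X m′ n
    weaken m≤m′ c≤c′ = ⊎.map (λ n<c → ≤-trans n<c c≤c′)
      (⊎.map₂ λ (a , Xa , a<n , n≤a+m) → a , Xa , a<n , ≤-trans n≤a+m (+-monoʳ-≤ a m≤m′))

  gapIdeal-isIdeal : GrowingGaps X → IsIdeal (GapIdeal X)
  gapIdeal-isIdeal gaps = record
    { ∪-closed   = ∪-closed′
    ; ⊆-closed   = λ Y Y′ Y⊆Y′ (m , c , small) → m , c , λ n Yn → small n (Y⊆Y′ n Yn)
    ; finite-mem = λ F (c , F-vanishes) → 0 , c , λ n Fn →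
        inj₁ (≰⇒> λ c≤n → true≢false Fn (F-vanishes n c≤n))
    ; proper     = proper′
    }
    where
    ∪-closed′ : ∀ Y Y′ → GapIdeal X Y → GapIdeal X Y′ → GapIdeal X (Y ∪ₛ Y′)
    ∪-closed′ Y Y′ (m , c , small) (m′ , c′ , small′) = m ℕ.+ m′ , c ℕ.+ c′ , small″
      where
      small″ : ∀ n → (Y ∪ₛ Y′) n ≡ true → n < c ℕ.+ c′ ⊎ X n ≡ false ⊎ NearBelow X (m ℕ.+ m′) n
      small″ n Y∪Y′n with ∨-≡-true {Y n} Y∪Y′n
      ... | inj₁ Yn  = weaken (m≤m+n m m′) (m≤m+n c c′) (small n Yn)
      ... | inj₂ Y′n = weaken (m≤n+m m′ m) (m≤n+m c′ c) (small′ n Y′n)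
    proper′ : ¬ GapIdeal X FullSet
    proper′ (m , c , small) with gaps m c
    ... | n , c≤n , Xn , isolated with small n refl
    ...   | inj₁ n<c              = <⇒≱ n<c c≤n
    ...   | inj₂ (inj₁ ¬Xn)       = true≢false Xn ¬Xn
    ...   | inj₂ (inj₂ nearBelow) = isolated nearBelow

  ∁-∈-gapIdeal : GapIdeal X (∁ X)
  ∁-∈-gapIdeal = 0 , 0 , λ n ∁Xn → inj₂ (inj₁ (not-injective ∁Xn))

  -- If B ∪ Near X m = ℕ, the complement of B + (m + 1) lies in GapIdeal X.
  gapIdeal-⊑⇒thin-t : ∀ {I} → IsIdeal I → GapIdeal X ⊑ I → Thin (t I) X
  gapIdeal-⊑⇒thin-t {I} I-ideal gap⊑I m B tB cover =
    ∁-∉ I-ideal B+1+m (tB (+ suc m)) (gap⊑I _ (m ℕ.+ suc m , suc m , small))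
    where
    B+1+m : Subset
    B+1+m = shift B (+ suc m)
    small : ∀ n → ∁ B+1+m n ≡ true → n < suc m ⊎ X n ≡ false ⊎ NearBelow X (m ℕ.+ suc m) n
    small n ∁B+1+mn with suc m ≤? n
    ... | no  n<1+m = inj₁ (≰⇒> n<1+m)
    ... | yes 1+m≤n with m∸n+n≡m 1+m≤n | cover (n ∸ suc m)
    ...   | r+1+m≡n | inj₁ Br =
      ⊥-elim (true≢false (shift-intro B (+ suc m) Br (cong +_ r+1+m≡n)) (not-injective ∁B+1+mn))
    ...   | r+1+m≡n | inj₂ (a , Xa , a≤r+m , r≤a+m) = inj₂ (inj₂ (a , Xa ,
      ≤-<-trans a≤r+m (subst (n ∸ suc m ℕ.+ m <_) r+1+m≡n (+-monoʳ-< (n ∸ suc m) (n<1+n m))) ,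
      subst (_≤ a ℕ.+ (m ℕ.+ suc m)) r+1+m≡n
        (≤-trans (+-monoˡ-≤ (suc m) r≤a+m) (≤-reflexive (+-assoc a m (suc m))))))

triangle : ℕ → ℕ
triangle zero    = 0
triangle (suc i) = triangle i ℕ.+ suc i

Triangular : Subset
Triangular n = isYes (any? λ (i : Fin (suc n)) → triangle (toℕ i) ≟ n)

n≤triangle : ∀ n → n ≤ triangle n
n≤triangle zero    = z≤n
n≤triangle (suc n) = m≤n+m (suc n) (triangle n)

triangle-+ : ∀ {i j} → i < j → triangle i ℕ.+ j ≤ triangle j
triangle-+ {i} {suc j} i<1+j with m≤n⇒m<n∨m≡n (≤-pred i<1+j)
... | inj₂ refl = ≤-refl
... | inj₁ i<j  = begin
  triangle i ℕ.+ suc j   ≡⟨ +-suc (triangle i) j ⟩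
  suc (triangle i ℕ.+ j) ≤⟨ s≤s (triangle-+ i<j) ⟩
  suc (triangle j)       ≤⟨ m<m+n (triangle j) z<s ⟩
  triangle j ℕ.+ suc j   ∎
  where open ≤-Reasoning

triangle-mono-≤ : ∀ {i j} → i ≤ j → triangle i ≤ triangle j
triangle-mono-≤ {i} i≤j with m≤n⇒m<n∨m≡n i≤j
... | inj₂ refl = ≤-refl
... | inj₁ i<j  = ≤-trans (m≤m+n (triangle i) _) (triangle-+ i<j)

Triangular-elim : ∀ {n} → Triangular n ≡ true → ∃ λ i → triangle i ≡ n
Triangular-elim e with toWitness (Equivalence.from T-≡ e)
... | i , triangle-i≡n = toℕ i , triangle-i≡n

Triangular-intro : ∀ i → Triangular (triangle i) ≡ true
Triangular-intro i = Equivalence.to T-≡ (fromWitness (fromℕ< i<1+n , cong triangle (toℕ-fromℕ< i<1+n)))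
  where
  i<1+n : i < suc (triangle i)
  i<1+n = s≤s (n≤triangle i)

triangular-growingGaps : GrowingGaps Triangular
triangular-growingGaps m c =
  triangle j , ≤-trans (m≤n+m c (suc m)) (n≤triangle j) , Triangular-intro j , isolated
  where
  j : ℕ
  j = suc (m ℕ.+ c)
  isolated : ¬ NearBelow Triangular m (triangle j)
  isolated (a , Ta , a<n , n≤a+m) with Triangular-elim Ta
  ... | i , refl = <⇒≱ (s≤s (m≤m+n m c))
    (+-cancelˡ-≤ (triangle i) _ _ (≤-trans (triangle-+ i<j) n≤a+m))
    where
    i<j : i < j
    i<j = ≰⇒> λ j≤i → <⇒≱ a<n (triangle-mono-≤ j≤i)

maximal-¬TMaximal-t : IdealExtension → Σ Family λ I → IsMaximalIdeal I × ¬ IsTMaximal (t I)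
maximal-¬TMaximal-t extend with extend _ (gapIdeal-isIdeal triangular-growingGaps)
... | I , I-maximal@(I-ideal , _) , gap⊑I = I , I-maximal , λ tI-TMaximal →
  ∁-∉ I-ideal Triangular
    (⊆-closed I-ideal _ _ (⊆-shift-0 Triangular)
      (TMaximal-∋-thin tI-TMaximal (gapIdeal-⊑⇒thin-t I-ideal gap⊑I) (+ 0)))
    (gap⊑I _ ∁-∈-gapIdeal)
  where open IsIdeal

-- Finite strings and limit points in the Cantor space

bit : List Bool → ℕ → Bool
bit []      _       = false
bit (b ∷ l) zero    = b
bit (b ∷ l) (suc i) = bit l i

bit-++ˡ : ∀ p q {i} → i < length p → bit (p ++ q) i ≡ bit p i
bit-++ˡ (b ∷ p) q {zero}  _           = refl
bit-++ˡ (b ∷ p) q {suc i} (s≤s i<∣p∣) = bit-++ˡ p q i<∣p∣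

bit-true⇒< : ∀ p {i} → bit p i ≡ true → i < length p
bit-true⇒< (b ∷ p) {zero}  _ = z<s
bit-true⇒< (b ∷ p) {suc i} e = s≤s (bit-true⇒< p e)

bit-replicate-false : ∀ k i → bit (replicate k false) i ≡ false
bit-replicate-false zero    i       = refl
bit-replicate-false (suc k) zero    = refl
bit-replicate-false (suc k) (suc i) = bit-replicate-false k i

bit-++-true : ∀ p q {j} → bit (p ++ q) j ≡ true →
  bit p j ≡ true ⊎ ∃ λ i → j ≡ length p ℕ.+ i × bit q i ≡ true
bit-++-true []      q {j}     e = inj₂ (j , refl , e)
bit-++-true (b ∷ p) q {zero}  e = inj₁ e
bit-++-true (b ∷ p) q {suc j} e =
  ⊎.map₂ (λ (i , j≡∣p∣+i , qi) → i , cong suc j≡∣p∣+i , qi) (bit-++-true p q e)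

bit-++-replicate-true : ∀ p k {i} → bit (p ++ replicate k false) i ≡ true → i < length p
bit-++-replicate-true p k e with bit-++-true p (replicate k false) e
... | inj₁ pi            = bit-true⇒< p pi
... | inj₂ (i′ , _ , zi′) = ⊥-elim (true≢false zi′ (bit-replicate-false k i′))

replicate-++-bit-true : ∀ k q {i} → bit (replicate k false ++ q) i ≡ true →
  ∃ λ i′ → i ≡ k ℕ.+ i′ × bit q i′ ≡ true
replicate-++-bit-true k q {i} e with bit-++-true (replicate k false) q e
... | inj₁ zi = ⊥-elim (true≢false zi (bit-replicate-false k i))
... | inj₂ (i′ , refl , qi′) rewrite length-replicate k {false} = i′ , refl , qi′

Extends-bit : ∀ x l → (∀ i → i < length l → x i ≡ bit l i) → Extends x l
Extends-bit x []      _     = tt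
Extends-bit x (b ∷ l) agree = agree 0 z<s , Extends-bit _ l (λ i i<∣l∣ → agree (suc i) (s≤s i<∣l∣))

Extends-++⁻ˡ : ∀ {x} p q → Extends x (p ++ q) → Extends x p
Extends-++⁻ˡ []      q _         = tt
Extends-++⁻ˡ (b ∷ p) q (x0 , ex) = x0 , Extends-++⁻ˡ p q ex

Extends-++-prefix : ∀ {x} p q r → Extends x (p ++ (q ++ r)) → Extends x (p ++ q)
Extends-++-prefix p q r ex = Extends-++⁻ˡ (p ++ q) r (subst (Extends _) (sym (++-assoc p q r)) ex)

map-not-involutive : ∀ l → map not (map not l) ≡ l
map-not-involutive l = trans (sym (map-∘ l)) (trans (map-cong not-involutive l) (map-id l))

Extends-∁ : ∀ {x} l → Extends x l → Extends (∁ x) (map not l)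
Extends-∁ []      _         = tt
Extends-∁ (b ∷ l) (x0 , ex) = cong not x0 , Extends-∁ l ex

prepend : List Bool → Subset → Subset
prepend []      x         = x
prepend (b ∷ s) x zero    = b
prepend (b ∷ s) x (suc n) = prepend s x n

prepend-++ : ∀ s {x} q → Extends x q → Extends (prepend s x) (s ++ q)
prepend-++ []      q ex = ex
prepend-++ (b ∷ s) q ex = refl , prepend-++ s q ex

prepend-extends : ∀ s x → Extends (prepend s x) s
prepend-extends s x = Extends-++⁻ˡ s [] (prepend-++ s [] tt)

prepend-length : ∀ s x n → prepend s x (length s ℕ.+ n) ≡ x n
prepend-length []      x n = refl
prepend-length (b ∷ s) x n = prepend-length s x n

⊆-shift-prepend : ∀ s y → y ⊆ₛ shift (prepend s y) (- + length s)
⊆-shift-prepend s y n yn = shift-intro (prepend s y) (- + length s)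
  (trans (prepend-length s y n) yn) ([i+j]-i≡j (+ length s) (+ n))

module Limit (seq : ℕ → List Bool) (step : ℕ → List Bool)
             (seq-zero : seq zero ≡ [])
             (seq-suc : ∀ n → seq (suc n) ≡ seq n ++ step n)
             (step-nonempty : ∀ n → 1 ≤ length (step n)) where

  seq-long : ∀ n → n ≤ length (seq n)
  seq-long zero    = z≤n
  seq-long (suc n) = begin
    suc n                              ≡⟨ +-comm 1 n ⟩
    n ℕ.+ 1                            ≤⟨ +-mono-≤ (seq-long n) (step-nonempty n) ⟩
    length (seq n) ℕ.+ length (step n) ≡⟨ sym (length-++ (seq n)) ⟩
    length (seq n ++ step n)           ≡⟨ cong length (sym (seq-suc n)) ⟩
    length (seq (suc n))               ∎
    where open ≤-Reasoning

  lim : Subset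
  lim j = bit (seq (suc j)) j

  seq-prefix : ∀ m d → ∃ λ q → seq (d ℕ.+ m) ≡ seq m ++ q
  seq-prefix m zero    = [] , sym (++-identityʳ (seq m))
  seq-prefix m (suc d) with seq-prefix m d
  ... | q , seq[d+m]≡ = q ++ step (d ℕ.+ m) ,
    trans (seq-suc (d ℕ.+ m)) (trans (cong (_++ step (d ℕ.+ m)) seq[d+m]≡) (++-assoc (seq m) q _))

  bit-seq-stable : ∀ {m n i} → m ≤ n → i < length (seq m) → bit (seq n) i ≡ bit (seq m) i
  bit-seq-stable {m} {n} {i} m≤n i<∣seqm∣ with seq-prefix m (n ∸ m)
  ... | q , seq≡ = begin
    bit (seq n) i                ≡⟨ cong (λ k → bit (seq k) i) (sym (m∸n+n≡m m≤n)) ⟩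
    bit (seq (n ∸ m ℕ.+ m)) i    ≡⟨ cong (λ l → bit l i) seq≡ ⟩
    bit (seq m ++ q) i           ≡⟨ bit-++ˡ (seq m) q i<∣seqm∣ ⟩
    bit (seq m) i                ∎
    where open ≡-Reasoning

  lim-extends : ∀ n → Extends lim (seq n)
  lim-extends n = Extends-bit lim (seq n) agree
    where
    agree : ∀ i → i < length (seq n) → lim i ≡ bit (seq n) i
    agree i i<∣seqn∣ with ≤-total (suc i) n
    ... | inj₁ 1+i≤n = sym (bit-seq-stable 1+i≤n (seq-long (suc i)))
    ... | inj₂ n≤1+i = bit-seq-stable n≤1+i i<∣seqn∣

  bit-seq-true : ∀ n {j} → bit (seq n) j ≡ true →
    ∃ λ k → ∃ λ i → j ≡ length (seq k) ℕ.+ i × bit (step k) i ≡ true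
  bit-seq-true zero    {j} e = ⊥-elim (true≢false e (cong (λ l → bit l j) seq-zero))
  bit-seq-true (suc n) {j} e with bit-++-true (seq n) (step n) (subst (λ l → bit l j ≡ true) (seq-suc n) e)
  ... | inj₁ seqn-j  = bit-seq-true n seqn-j
  ... | inj₂ (i , j≡ , stepn-i) = n , i , j≡ , stepn-i

  lim-true : ∀ {j} → lim j ≡ true → ∃ λ k → ∃ λ i → j ≡ length (seq k) ℕ.+ i × bit (step k) i ≡ true
  lim-true = bit-seq-true _

-- Points outside a countable union of nowhere dense sets

module AvoidingAll (N : ℕ → Family) (N-nowhereDense : ∀ n → NowhereDense (N n)) where
  private
    avoid : ℕ → List Bool → List Bool
    avoid n p = proj₁ (N-nowhereDense n p)

    avoids : ∀ n p {z} → Extends z (p ++ avoid n p) → ¬ N n z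
    avoids n p = proj₂ (N-nowhereDense n p) _

  module _ (s : List Bool) where
    private
      -- u keeps prepend s x out of N n and u∁, stored flipped, keeps prepend s (∁ x) out;
      -- the trailing bit only makes every segment nonempty.
      u u∁ : ℕ → List Bool → List Bool
      u n p = avoid n (s ++ p)
      u∁ n p = avoid n (s ++ map not (p ++ u n p))

      segment : ℕ → List Bool → List Bool
      segment n p = u n p ++ (map not (u∁ n p) ++ false ∷ [])

      approx : ℕ → List Bool
      approx zero    = []
      approx (suc n) = approx n ++ segment n (approx n)

      segment-nonempty : ∀ n → 1 ≤ length (segment n (approx n))
      segment-nonempty n = ≤-trans (length-++-≤ʳ (false ∷ []) {map not (u∁ n p)}) (length-++-≤ʳ _ {u n p})
        where
        p : List Bool
        p = approx n

      open Limit approx (λ n → segment n (approx n)) refl (λ _ → refl) segment-nonempty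

    flipGeneric : ∃ λ x → (∀ n → ¬ N n (prepend s x)) × (∀ n → ¬ N n (prepend s (∁ x)))
    flipGeneric = lim , prepend-lim-avoids , prepend-∁lim-avoids
      where
      prepend-lim-avoids : ∀ n → ¬ N n (prepend s lim)
      prepend-lim-avoids n = avoids n (s ++ p)
        (subst (Extends _) (sym (++-assoc s p _))
          (prepend-++ s (p ++ u n p) (Extends-++-prefix p _ _ (lim-extends (suc n)))))
        where
        p : List Bool
        p = approx n

      prepend-∁lim-avoids : ∀ n → ¬ N n (prepend s (∁ lim))
      prepend-∁lim-avoids n = avoids n (s ++ map not (p ++ u n p))
        (subst (Extends _) (sym (++-assoc s _ _))
          (prepend-++ s _ (subst (Extends (∁ lim)) flip-back ∁lim-extends)))
        where
        p w : List Bool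
        p = approx n
        w = map not (u∁ n p)
        lim-extends′ : Extends lim ((p ++ u n p) ++ w)
        lim-extends′ = subst (Extends lim) (sym (++-assoc p (u n p) w))
          (Extends-++-prefix p (u n p ++ w) (false ∷ [])
            (subst (Extends lim) (cong (p ++_) (sym (++-assoc (u n p) w _))) (lim-extends (suc n))))
        ∁lim-extends : Extends (∁ lim) (map not ((p ++ u n p) ++ w))
        ∁lim-extends = Extends-∁ _ lim-extends′
        flip-back : map not ((p ++ u n p) ++ w) ≡ map not (p ++ u n p) ++ u∁ n p
        flip-back = trans (map-++ not (p ++ u n p) w)
          (cong (map not (p ++ u n p) ++_) (map-not-involutive (u∁ n p)))

  -- Stage k appends to A a segment keeping it out of N k, and to D, after U k + k zeros,
  -- a segment keeping it out of N k; both are then padded with zeros to a common length,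
  -- so that the ones of D at stage k are more than k away from all ones of A.
  private
    Stage : Set
    Stage = List Bool × List Bool

    uA uD : ℕ → Stage → List Bool
    uA k (a , d) = avoid k a
    uD k (a , d) = avoid k (d ++ replicate (length (uA k (a , d)) ℕ.+ k) false)

    segmentA segmentD : ℕ → Stage → List Bool
    segmentA k st = uA k st ++ replicate (k ℕ.+ (length (uD k st) ℕ.+ suc k)) false
    segmentD k st = replicate (length (uA k st) ℕ.+ k) false ++ (uD k st ++ replicate (suc k) false)

    stage : ℕ → Stage
    stage zero    = [] , []
    stage (suc k) = proj₁ (stage k) ++ segmentA k (stage k) , proj₂ (stage k) ++ segmentD k (stage k)

    a d : ℕ → List Bool
    a k = proj₁ (stage k)
    d k = proj₂ (stage k)

    L U V block : ℕ → ℕ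
    L k = length (a k)
    U k = length (uA k (stage k))
    V k = length (uD k (stage k))
    block k = U k ℕ.+ k ℕ.+ V k ℕ.+ suc k

    length-segmentA : ∀ k → length (segmentA k (stage k)) ≡ block k
    length-segmentA k = begin
      length (segmentA k (stage k))      ≡⟨ length-++ (uA k (stage k)) ⟩
      U k ℕ.+ length (replicate (k ℕ.+ (V k ℕ.+ suc k)) false)
                                         ≡⟨ cong (U k ℕ.+_) (length-replicate (k ℕ.+ (V k ℕ.+ suc k))) ⟩
      U k ℕ.+ (k ℕ.+ (V k ℕ.+ suc k))    ≡⟨ sym (+-assoc (U k) k _) ⟩
      U k ℕ.+ k ℕ.+ (V k ℕ.+ suc k)      ≡⟨ sym (+-assoc (U k ℕ.+ k) (V k) (suc k)) ⟩
      block k                            ∎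
      where open ≡-Reasoning

    length-segmentD : ∀ k → length (segmentD k (stage k)) ≡ block k
    length-segmentD k = begin
      length (segmentD k (stage k))                  ≡⟨ length-++ (replicate (U k ℕ.+ k) false) ⟩
      length (replicate (U k ℕ.+ k) false) ℕ.+ length (uD k (stage k) ++ replicate (suc k) false)
                                                     ≡⟨ cong₂ ℕ._+_ (length-replicate (U k ℕ.+ k))
                                                          (length-++ (uD k (stage k))) ⟩
      U k ℕ.+ k ℕ.+ (V k ℕ.+ length (replicate (suc k) false))
                                                     ≡⟨ cong (λ z → U k ℕ.+ k ℕ.+ (V k ℕ.+ z)) (length-replicate (suc k)) ⟩
      U k ℕ.+ k ℕ.+ (V k ℕ.+ suc k)                  ≡⟨ sym (+-assoc (U k ℕ.+ k) (V k) (suc k)) ⟩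
      block k                                        ∎
      where open ≡-Reasoning

    block-nonempty : ∀ k → 1 ≤ block k
    block-nonempty k = subst (1 ≤_) (sym (+-suc (U k ℕ.+ k ℕ.+ V k) k)) (s≤s z≤n)

    L-suc : ∀ k → L (suc k) ≡ L k ℕ.+ block k
    L-suc k = trans (length-++ (a k)) (cong (L k ℕ.+_) (length-segmentA k))

    length-d : ∀ k → length (d k) ≡ L k
    length-d zero    = refl
    length-d (suc k) = begin
      length (d k ++ segmentD k (stage k))     ≡⟨ length-++ (d k) ⟩
      length (d k) ℕ.+ length (segmentD k _)   ≡⟨ cong₂ ℕ._+_ (length-d k) (length-segmentD k) ⟩
      L k ℕ.+ block k                          ≡⟨ sym (L-suc k) ⟩
      L (suc k)                                ∎
      where open ≡-Reasoning

    module LA = Limit a (λ k → segmentA k (stage k)) refl (λ _ → refl)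
      (λ k → subst (1 ≤_) (sym (length-segmentA k)) (block-nonempty k))
    module LD = Limit d (λ k → segmentD k (stage k)) refl (λ _ → refl)
      (λ k → subst (1 ≤_) (sym (length-segmentD k)) (block-nonempty k))

    L-step : ∀ k → L k ≤ L (suc k)
    L-step k = subst (L k ≤_) (sym (L-suc k)) (m≤m+n (L k) (block k))

    L-mono : ∀ {k k′} → k ≤ k′ → L k ≤ L k′
    L-mono k≤k′ = go (≤⇒≤′ k≤k′)
      where
      go : ∀ {k k′} → k ≤′ k′ → L k ≤ L k′
      go (≤′-reflexive refl)        = ≤-refl
      go {k′ = suc k′} (≤′-step k≤′k′) = ≤-trans (go k≤′k′) (L-step k′)

  A D : Subset
  A = LA.lim
  D = LD.lim

  A-avoids : ∀ k → ¬ N k A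
  A-avoids k = avoids k (a k) (Extends-++-prefix (a k) (uA k (stage k)) _ (LA.lim-extends (suc k)))

  D-avoids : ∀ k → ¬ N k D
  D-avoids k = avoids k (d k ++ zeros) (subst (Extends D) (sym (++-assoc (d k) zeros _))
    (Extends-++-prefix (d k) (zeros ++ uD k (stage k)) (replicate (suc k) false)
      (subst (Extends D) (cong (d k ++_) (sym (++-assoc zeros (uD k (stage k)) _))) (LD.lim-extends (suc k)))))
    where
    zeros : List Bool
    zeros = replicate (U k ℕ.+ k) false

  private
    U≤block : ∀ k → U k ≤ block k
    U≤block k = ≤-trans (m≤m+n (U k) k) (≤-trans (m≤m+n _ (V k)) (m≤m+n _ (suc k)))

    L+U-mono : ∀ {k′ k} → k′ ≤ k → L k′ ℕ.+ U k′ ≤ L k ℕ.+ U k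
    L+U-mono {k′} {k} k′≤k with m≤n⇒m<n∨m≡n k′≤k
    ... | inj₂ refl = ≤-refl
    ... | inj₁ k′<k = begin
      L k′ ℕ.+ U k′     ≤⟨ +-monoʳ-≤ (L k′) (U≤block k′) ⟩
      L k′ ℕ.+ block k′ ≡⟨ sym (L-suc k′) ⟩
      L (suc k′)        ≤⟨ L-mono k′<k ⟩
      L k               ≤⟨ m≤m+n (L k) (U k) ⟩
      L k ℕ.+ U k       ∎
      where open ≤-Reasoning

    A-zone : ∀ {j} → A j ≡ true → ∃ λ k → L k ≤ j × j < L k ℕ.+ U k
    A-zone {j} Aj with LA.lim-true {j} Aj
    ... | k , i , refl , segment-i =
      k , m≤m+n (L k) i , +-monoʳ-< (L k) (bit-++-replicate-true (uA k (stage k)) _ segment-i)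

    D-zone : ∀ {i} → D i ≡ true → ∃ λ k → L k ℕ.+ U k ℕ.+ k ≤ i × i ℕ.+ k < L (suc k)
    D-zone {i} Di with LD.lim-true {i} Di
    ... | k , i₀ , refl , segment-i₀ with replicate-++-bit-true (U k ℕ.+ k) _ segment-i₀
    ...   | i′ , refl , uD-i′ rewrite length-d k = k , lower , upper
      where
      i′<V : i′ < V k
      i′<V = bit-++-replicate-true (uD k (stage k)) (suc k) uD-i′
      lower : L k ℕ.+ U k ℕ.+ k ≤ L k ℕ.+ (U k ℕ.+ k ℕ.+ i′)
      lower = subst (_≤ L k ℕ.+ (U k ℕ.+ k ℕ.+ i′)) (sym (+-assoc (L k) (U k) k))
        (+-monoʳ-≤ (L k) (m≤m+n (U k ℕ.+ k) i′))
      upper : L k ℕ.+ (U k ℕ.+ k ℕ.+ i′) ℕ.+ k < L (suc k)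
      upper = begin-strict
        L k ℕ.+ (U k ℕ.+ k ℕ.+ i′) ℕ.+ k   ≡⟨ +-assoc (L k) _ k ⟩
        L k ℕ.+ (U k ℕ.+ k ℕ.+ i′ ℕ.+ k)   <⟨ +-monoʳ-< (L k) (+-monoˡ-< k (+-monoʳ-< (U k ℕ.+ k) i′<V)) ⟩
        L k ℕ.+ (U k ℕ.+ k ℕ.+ V k ℕ.+ k)  ≤⟨ +-monoʳ-≤ (L k) (+-monoʳ-≤ (U k ℕ.+ k ℕ.+ V k) (n≤1+n k)) ⟩
        L k ℕ.+ block k                    ≡⟨ sym (L-suc k) ⟩
        L (suc k)                          ∎
        where open ≤-Reasoning

    D-A-apart : ∀ {i j} → D i ≡ true → A j ≡ true → ∃ λ k → i < L (suc k) × (j ℕ.+ k < i ⊎ i ℕ.+ k < j)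
    D-A-apart {i} {j} Di Aj with D-zone Di | A-zone Aj
    ... | k , lowerD , upperD | k′ , lowerA , upperA with k′ ≤? k
    ...   | yes k′≤k = k , ≤-<-trans (m≤m+n i k) upperD , inj₁ (begin-strict
      j ℕ.+ k                  <⟨ +-monoˡ-< k (<-≤-trans upperA (L+U-mono k′≤k)) ⟩
      L k ℕ.+ U k ℕ.+ k        ≤⟨ lowerD ⟩
      i                        ∎)
      where open ≤-Reasoning
    ...   | no k′≰k = k , ≤-<-trans (m≤m+n i k) upperD ,
      inj₂ (<-≤-trans upperD (≤-trans (L-mono (≰⇒> k′≰k)) lowerA))

  D-far-from-A : ∀ m → ∃ λ c → ∀ {i} → D i ≡ true → Near A m i → i < c
  D-far-from-A m = L m , far
    where
    far : ∀ {i} → D i ≡ true → Near A m i → i < L m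
    far {i} Di (j , Aj , j≤i+m , i≤j+m) with i <? L m | D-A-apart Di Aj
    ... | yes i<Lm | _ = i<Lm
    ... | no i≮Lm | k , i<L[1+k] , apart = ⊥-elim (case apart)
      where
      m≤k : m ≤ k
      m≤k = ≮⇒≥ λ k<m → <⇒≱ i<L[1+k] (≤-trans (L-mono k<m) (≮⇒≥ i≮Lm))
      case : j ℕ.+ k < i ⊎ i ℕ.+ k < j → ⊥
      case (inj₁ j+k<i) = <⇒≱ j+k<i (≤-trans i≤j+m (+-monoʳ-≤ j m≤k))
      case (inj₂ i+k<j) = <⇒≱ i+k<j (≤-trans j≤i+m (+-monoʳ-≤ i m≤k))

-- Baire category

module _ {J : Family} (J-ideal : IsIdeal J) (J-invariant : TranslationInvariant J) where
  open IsIdeal J-ideal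

  ¬meager-basic∖ideal : ∀ s → ¬ Meager (λ x → Extends x s × ¬ J x)
  ¬meager-basic∖ideal s (N , N-nowhereDense , cover) with AvoidingAll.flipGeneric N N-nowhereDense s
  ... | x , x-avoids , ∁x-avoids =
    ¬¬J x x-avoids λ Jsx → ¬¬J (∁ x) ∁x-avoids λ Js∁x →
      ∁-∉ J-ideal x (unprepend Jsx) (unprepend Js∁x)
    where
    -- Without excluded middle only ¬¬ J is available, which suffices as the goal is ⊥.
    ¬¬J : ∀ z → (∀ n → ¬ N n (prepend s z)) → DoubleNegation (J (prepend s z))
    ¬¬J z avoids ¬J = uncurry avoids (cover (prepend s z) (prepend-extends s z , ¬J))
    unprepend : ∀ {z} → J (prepend s z) → J z
    unprepend {z} Jsz = ⊆-closed z _ (⊆-shift-prepend s z) (J-invariant _ (- + length s) Jsz)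

TMaximal-¬meager : ∀ {J} → IsTMaximal J → ¬ Meager J
TMaximal-¬meager {J} J-TMaximal@(J-ideal , _) (N , N-nowhereDense , cover) =
  uncurry A-avoids (cover A (TMaximal-∋-thin J-TMaximal A-thin))
  where
  open IsIdeal J-ideal
  open AvoidingAll N N-nowhereDense
  A-thin : Thin J A
  A-thin m B JB B∪NearA = uncurry D-avoids (cover D JD)
    where
    c : ℕ
    c = proj₁ (D-far-from-A m)
    D⊆B∪Below : D ⊆ₛ (B ∪ₛ Below c)
    D⊆B∪Below i Di with B∪NearA i
    ... | inj₁ Bi      = ⊆-∪ˡ B (Below c) i Bi
    ... | inj₂ nearA-i = ⊆-∪ʳ B (Below c) i (Below-intro (proj₂ (D-far-from-A m) Di nearA-i))
    JD : J D
    JD = ⊆-closed D _ D⊆B∪Below (∪-closed B (Below c) JB (finite-mem _ (Below-finite c)))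

TMaximal-¬baire : LEM → (J : Family) → IsTMaximal J → ¬ HasBaireProperty J
TMaximal-¬baire lem J J-TMaximal@(J-ideal , J-invariant , _) (W , N , N-nowhereDense , cover)
  with lem (Lift _ (∃ W))
... | inj₁ (lift (s , Ws)) = ¬meager-basic∖ideal J-ideal J-invariant s
  (N , N-nowhereDense , λ x (x∈[s] , ¬Jx) → cover x (inj₂ ((s , Ws , x∈[s]) , ¬Jx)))
... | inj₂ W-empty = TMaximal-¬meager J-TMaximal
  (N , N-nowhereDense , λ x Jx → cover x (inj₁ (Jx , λ (s , Ws , _) → W-empty (lift (s , Ws)))))

theorem3p13 : LEM → IdealExtension →
    ((J : Family) → IsTMaximal J → (I : Family) → IsMaximalIdeal I → J ⊑ I → J ≐ t I)
    × (Σ Family λ I → IsMaximalIdeal I × ¬ IsTMaximal (t I))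
    × ((J : Family) → IsTMaximal J → ¬ HasBaireProperty J)
theorem3p13 lem extend = TMaximal⇒≐t , maximal-¬TMaximal-t extend , TMaximal-¬baire lem
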